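{- Let $I\subseteq[n]$, $\overline J\subseteq[\overline n]$ be a valid pair. Then the graph $G(I,\overline J)$, regarded as an undirected graph, is acyclic.
   Context: Fix $n\ge1$, $[n]=\{1,\dots,n\}$, $[\overline n]=\{\overline1,\dots,\overline n\}$, totally ordered by $1\prec\overline1\prec2\prec\overline2\prec\cdots\prec n\prec\overline n$. A pair $I\subseteq[n]$, $\overline J\subseteq[\overline n]$ is valid if $\min(I\sqcup\overline J)\in I$ and $\max(I\sqcup\overline J)\in\overline J$ (w.r.t. $\prec$). Define $\mathrm{prec}:\overline J\to[n]$: if in $\prec$ restricted to $I\sqcup\overline J$ the element $\overline j$ is immediately preceded by some $i\in I$, then $\mathrm{prec}(\overline j)=i$; otherwise $\mathrm{prec}(\overline j)=j$. Let $\mathrm{prec}(A(I,\overline J))$ be the simple directed graph on vertex set $I\cup\mathrm{prec}(\overline J)\subseteq[n]$ with edges $(i,\mathrm{prec}(\overline j))$ for all $i\in I$, $\overline j\in\overline J$ with $i<\mathrm{prec}(\overline j)$. For a simple directed graph $H$ on a subset of $[n]$ with edges directed from smaller to larger vertex, $\min(H)$ is obtained by deleting each edge $(i,j)$ for which $H$ contains a directed path $i,i_1,\dots,i_k,j$ with $k\ge1$. Define $G(I,\overline J)=\min(\mathrm{prec}(A(I,\overline J)))$. -}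

module Defs where

open import Data.Nat using (ℕ; _+_; _*_; _<_; _≤_)
open import Data.Fin using (Fin; toℕ)
open import Data.Fin.Subset using (Subset; _∈_)
open import Data.Sum using (_⊎_; inj₁; inj₂)
open import Data.Product using (Σ; _×_; ∃)
open import Data.List using (List; []; _∷_; _++_; [_]; length)
open import Data.List.Relation.Unary.Linked using (Linked)
open import Data.List.Relation.Unary.Unique.Propositional using (Unique)
open import Relation.Nullary using (¬_)
open import Data.Empty using (⊥)
open import Relation.Binary.PropositionalEquality using (_≡_)

-- Elements of [n] ⊔ [n̄] (0-indexed): inj₁ i is the unbarred i, inj₂ j is the barred j̄.
Elem : ℕ → Set
Elem n = Fin n ⊎ Fin n

-- Position in the total order 1 ≺ 1̄ ≺ 2 ≺ 2̄ ≺ ⋯ : i ↦ 2i, ī ↦ 2i+1.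
key : ∀ {n} → Elem n → ℕ
key (inj₁ i) = 2 * toℕ i
key (inj₂ j) = 2 * toℕ j + 1

_≺_ : ∀ {n} → Elem n → Elem n → Set
x ≺ y = key x < key y

_≼_ : ∀ {n} → Elem n → Elem n → Set
x ≼ y = key x ≤ key y

-- membership in I ⊔ J̄ (J̄ is represented by the set J ⊆ [n] of indices)
InU : ∀ {n} → Subset n → Subset n → Elem n → Set
InU I J (inj₁ i) = i ∈ I
InU I J (inj₂ j) = j ∈ J

Valid : ∀ {n} → Subset n → Subset n → Set
Valid {n} I J =
  (Σ (Fin n) λ i → i ∈ I × (∀ y → InU I J y → inj₁ i ≼ y)) ×
  (Σ (Fin n) λ j → j ∈ J × (∀ y → InU I J y → y ≼ inj₂ j))

ImmPred : ∀ {n} → Subset n → Subset n → Elem n → Elem n → Set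
ImmPred I J y x =
  InU I J y × y ≺ x × (∀ z → InU I J z → y ≺ z → z ≺ x → ⊥)

PrecIs : ∀ {n} → Subset n → Subset n → Fin n → Fin n → Set
PrecIs {n} I J j k =
  ImmPred I J (inj₁ k) (inj₂ j) ⊎
  ((∀ (i : Fin n) → ¬ ImmPred I J (inj₁ i) (inj₂ j)) × k ≡ j)

PrecAEdge : ∀ {n} → Subset n → Subset n → Fin n → Fin n → Set
PrecAEdge {n} I J a b =
  a ∈ I × (Σ (Fin n) λ j → j ∈ J × PrecIs I J j b) × toℕ a < toℕ b

data Path {n} (E : Fin n → Fin n → Set) : Fin n → Fin n → Set where
  edge : ∀ {a b} → E a b → Path E a b
  step : ∀ {a b c} → E a b → Path E b c → Path E a c

MinEdge : ∀ {n} → (Fin n → Fin n → Set) → Fin n → Fin n → Set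
MinEdge {n} E a b = E a b × ¬ (Σ (Fin n) λ c → E a c × Path E c b)

GEdge : ∀ {n} → Subset n → Subset n → Fin n → Fin n → Set
GEdge I J = MinEdge (PrecAEdge I J)

UAdj : ∀ {n} → (Fin n → Fin n → Set) → Fin n → Fin n → Set
UAdj E a b = E a b ⊎ E b a

IsCycle : ∀ {n} → (Fin n → Fin n → Set) → List (Fin n) → Set
IsCycle E [] = ⊥
IsCycle E (v ∷ vs) = 3 ≤ length (v ∷ vs) × Unique (v ∷ vs) × Linked (UAdj E) (v ∷ vs ++ [ v ])

UAcyclic : ∀ {n} → (Fin n → Fin n → Set) → Set
UAcyclic {n} E = ∀ (cs : List (Fin n)) → ¬ IsCycle E cs

-- Rank the vertices by  rank v = 1 + v  for v ∈ I  and  rank v = 0  otherwise.  Every edge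
-- i → prec(j̄) starts in I and increases the index, so adjacent vertices have different ranks,
-- and minimality of G leaves every vertex at most one neighbour of higher rank: for v ∈ I two
-- out-neighbours u < w in I would give a path v → u → w, and for v ∉ I two in-neighbours u < w
-- would give a path u → s → v, where s is the last element of I before v, which is prec of the
-- first element of J̄ after it.  With such a ranking a non-backtracking walk keeps descending once
-- it descends and has only ascended before an ascent, so no walk can go around a cycle.
module Submission where

open import Defs
open import Data.Nat using (ℕ; zero; suc; _+_; _*_; _<_; _≮_; _≤_; z≤n; s≤s; _≤?_; _≟_)
open import Data.Nat.Properties
open import Data.Fin using (Fin; toℕ)
open import Data.Fin.Properties using (toℕ-injective; any?)
open import Data.Fin.Subset using (Subset; _∈_; _∉_)
open import Data.Fin.Subset.Properties using (_∈?_)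
open import Data.Sum using (_⊎_; inj₁; inj₂; [_,_]′; swap)
open import Data.Product using (Σ; _×_; _,_)
open import Data.List using (List; []; _∷_; _++_; [_])
open import Data.List.Membership.Propositional using () renaming (_∈_ to _∈ₗ_)
open import Data.List.Membership.Propositional.Properties using (∈-++⁺ʳ)
open import Data.List.Relation.Unary.Any using (here; there)
open import Data.List.Relation.Unary.All using (All; _∷_)
import Data.List.Relation.Unary.All as All
open import Data.List.Relation.Unary.AllPairs using (_∷_)
open import Data.List.Relation.Unary.Linked using (Linked; [-]; _∷_; head)
open import Data.List.Relation.Unary.Linked.Properties using (Linked⇒All)
open import Data.List.Relation.Unary.Unique.Propositional using (Unique)
open import Data.Unit using (⊤; tt)
open import Data.Empty using (⊥)
open import Function using (_on_; flip; _∘_; case_of_)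
open import Relation.Nullary using (¬_; yes; no; contradiction)
open import Relation.Nullary.Decidable using (_×-dec_)
open import Relation.Unary using (Decidable)
open import Relation.Binary using (Rel; Transitive)
open import Relation.Binary.PropositionalEquality using (_≡_; _≢_; refl; sym; subst; subst₂; ≢-sym)
open import Relation.Binary.Definitions using (tri<; tri≈; tri>)

module _ {A : Set} where

  Linked-revisit : ∀ {ℓ} {R : Rel A ℓ} → Transitive R →
                   ∀ {x xs} → Linked R (x ∷ xs) → x ∈ₗ xs → R x x
  Linked-revisit trans (r ∷ rs) x∈xs = All.lookup (Linked⇒All trans r rs) x∈xs

  Linked-∷ʳ : ∀ {ℓ} {R : Rel A ℓ} xs {y z} → Linked R (xs ++ [ y ]) → R y z →
              Linked R (xs ++ y ∷ [ z ])
  Linked-∷ʳ []            _         ryz = ryz ∷ [-]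
  Linked-∷ʳ (x ∷ [])      (r ∷ [-]) ryz = r ∷ ryz ∷ [-]
  Linked-∷ʳ (x ∷ x′ ∷ xs) (r ∷ rs)  ryz = r ∷ Linked-∷ʳ (x′ ∷ xs) rs ryz

  NoBacktrack : List A → Set
  NoBacktrack (x ∷ xs@(_ ∷ z ∷ _)) = x ≢ z × NoBacktrack xs
  NoBacktrack _                    = ⊤

  -- once around the cycle v w u us, then along its first edge again
  closedWalk-noBacktrack : ∀ {v w u us} → Unique (v ∷ w ∷ u ∷ us) →
                           NoBacktrack (v ∷ w ∷ u ∷ us ++ v ∷ [ w ])
  closedWalk-noBacktrack {v} {w} (v≢ ∷ w≢ ∷ unique) =
    All.head (All.tail v≢) , go _ _ _ (w≢ ∷ unique) v≢ w≢
    where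
      go : ∀ p q rs → Unique (p ∷ q ∷ rs) → All (v ≢_) (p ∷ q ∷ rs) → All (w ≢_) (q ∷ rs) →
           NoBacktrack (p ∷ q ∷ rs ++ v ∷ [ w ])
      go p q []       _                        (v≢p ∷ _) (w≢q ∷ _) = ≢-sym v≢p , ≢-sym w≢q , tt
      go p q (r ∷ rs) ((_ ∷ p≢r ∷ _) ∷ unique) (_ ∷ v≢) (_ ∷ w≢) =
        p≢r , go q r rs unique v≢ w≢

  LastStep : ∀ {ℓ} → Rel A ℓ → A → A → List A → Set ℓ
  LastStep R x y []       = R x y
  LastStep R x y (z ∷ zs) = LastStep R y z zs

  LastStep-∷ʳ : ∀ {ℓ} {R : Rel A ℓ} {x y} zs {e f} → R e f → LastStep R x y (zs ++ e ∷ [ f ])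
  LastStep-∷ʳ []       ref = ref
  LastStep-∷ʳ (z ∷ zs) ref = LastStep-∷ʳ zs ref

module Ranked {n : ℕ} (E : Fin n → Fin n → Set) (rank : Fin n → ℕ)
  (adjacent⇒rank≢ : ∀ {a b} → UAdj E a b → rank a ≢ rank b)
  (higherNeighbour-unique : ∀ {v u w} → UAdj E v u → UAdj E v w →
                            rank v < rank u → rank v < rank w → u ≡ w)
  where

  private
    Adj : Fin n → Fin n → Set
    Adj = UAdj E

    _<ʳ_ _>ʳ_ : Fin n → Fin n → Set
    _<ʳ_ = _<_ on rank
    _>ʳ_ = flip _<ʳ_

  adjacent-rank-cmp : ∀ {a b} → Adj a b → a <ʳ b ⊎ b <ʳ a
  adjacent-rank-cmp {a} {b} ab with <-cmp (rank a) (rank b)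
  ... | tri< a<b _ _ = inj₁ a<b
  ... | tri≈ _ a≡b _ = contradiction a≡b (adjacent⇒rank≢ ab)
  ... | tri> _ _ b<a = inj₂ b<a

  descent-continues : ∀ {x y z} → Adj x y → Adj y z → x ≢ z → y <ʳ x → z <ʳ y
  descent-continues xy yz x≢z y<x with adjacent-rank-cmp yz
  ... | inj₂ z<y = z<y
  ... | inj₁ y<z = contradiction (higherNeighbour-unique (swap xy) yz y<x y<z) x≢z

  ascent-precedes : ∀ {x y z} → Adj x y → Adj y z → x ≢ z → y <ʳ z → x <ʳ y
  ascent-precedes xy yz x≢z y<z with adjacent-rank-cmp xy
  ... | inj₁ x<y = x<y
  ... | inj₂ y<x = contradiction (higherNeighbour-unique (swap xy) yz y<x y<z) x≢z

  descending : ∀ {x y zs} → Linked Adj (x ∷ y ∷ zs) → NoBacktrack (x ∷ y ∷ zs) →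
               y <ʳ x → Linked _>ʳ_ (x ∷ y ∷ zs)
  descending {zs = []}    (_ ∷ [-])          _          y<x = y<x ∷ [-]
  descending {zs = _ ∷ _} (xy ∷ yz ∷ walk) (x≢z , nb) y<x =
    y<x ∷ descending (yz ∷ walk) nb (descent-continues xy yz x≢z y<x)

  ascending : ∀ {x y zs} → Linked Adj (x ∷ y ∷ zs) → NoBacktrack (x ∷ y ∷ zs) →
              LastStep _<ʳ_ x y zs → Linked _<ʳ_ (x ∷ y ∷ zs)
  ascending {zs = []}    (_ ∷ [-])          _          x<y  = x<y ∷ [-]
  ascending {zs = _ ∷ _} (xy ∷ yz ∷ walk) (x≢z , nb) last =
    let rest = ascending (yz ∷ walk) nb last in ascent-precedes xy yz x≢z (head rest) ∷ rest

  acyclic : UAcyclic E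
  acyclic []               ()
  acyclic (_ ∷ [])         (s≤s () , _)
  acyclic (_ ∷ _ ∷ [])     (s≤s (s≤s ()) , _)
  acyclic (v ∷ w ∷ u ∷ us) (_ , unique , cycle) =
    [ (λ v<w → <-irrefl refl (Linked-revisit {R = _<ʳ_} <-trans
                 (ascending walk noBacktrack (LastStep-∷ʳ {x = v} (u ∷ us) v<w)) returns))
    , (λ w<v → <-irrefl refl (Linked-revisit {R = _>ʳ_} (flip <-trans)
                 (descending walk noBacktrack w<v) returns))
    ]′ (adjacent-rank-cmp (head cycle))
    where
      walk : Linked Adj (v ∷ w ∷ u ∷ us ++ v ∷ [ w ])
      walk = Linked-∷ʳ (v ∷ w ∷ u ∷ us) cycle (head cycle)
      noBacktrack : NoBacktrack (v ∷ w ∷ u ∷ us ++ v ∷ [ w ])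
      noBacktrack = closedWalk-noBacktrack unique
      returns : v ∈ₗ w ∷ u ∷ us ++ v ∷ [ w ]
      returns = there (there (∈-++⁺ʳ us (here refl)))

greatest-below : ∀ {P : ℕ → Set} → Decidable P → ∀ {y} hi → y < hi → P y →
                 Σ ℕ λ x → x < hi × P x × (∀ {z} → x < z → z < hi → ¬ P z)
greatest-below P? (suc h) y<1+h Py with P? h
... | yes Ph = h , n<1+n h , Ph , λ h<z z<1+h _ → <⇒≱ h<z (m<1+n⇒m≤n z<1+h)
... | no ¬Ph with m<1+n⇒m<n∨m≡n y<1+h
...   | inj₂ refl = contradiction Py ¬Ph
...   | inj₁ y<h with greatest-below P? h y<h Py
...     | x , x<h , Px , maximal =
  x , m<n⇒m<1+n x<h , Px ,
  λ x<z z<1+h → [ maximal x<z , (λ { refl → ¬Ph }) ]′ (m<1+n⇒m<n∨m≡n z<1+h)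

least-upTo : ∀ {P : ℕ → Set} → Decidable P → ∀ hi → P hi →
             Σ ℕ λ x → x ≤ hi × P x × (∀ {y} → y < x → ¬ P y)
least-upTo P? hi Phi with P? 0
... | yes P0 = 0 , z≤n , P0 , λ ()
least-upTo P? zero P0 | no ¬P0 = contradiction P0 ¬P0
least-upTo P? (suc hi) Phi | no ¬P0 with least-upTo (P? ∘ suc) hi Phi
... | x , x≤hi , Px , minimal =
  suc x , s≤s x≤hi , Px , λ { {zero} _ → ¬P0 ; {suc y} (s≤s y<x) → minimal y<x }

≺-inj₁ : ∀ {n} {i i′ : Fin n} → inj₁ i ≺ inj₁ i′ → toℕ i < toℕ i′
≺-inj₁ {i = i} {i′} = *-cancelˡ-< 2 (toℕ i) (toℕ i′)

≺-inj₂ : ∀ {n} {j j′ : Fin n} → inj₂ j ≺ inj₂ j′ → toℕ j < toℕ j′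
≺-inj₂ {j = j} {j′} = *-cancelˡ-< 2 (toℕ j) (toℕ j′) ∘ +-cancelʳ-< 1 (2 * toℕ j) (2 * toℕ j′)

≺-inj₁-inj₂ : ∀ {n} {i j : Fin n} → inj₁ i ≺ inj₂ j → toℕ i ≤ toℕ j
≺-inj₁-inj₂ {i = i} {j} i≺j =
  *-cancelˡ-≤ 2 (m<1+n⇒m≤n (subst (2 * toℕ i <_) (+-comm (2 * toℕ j) 1) i≺j))

≤⇒≺-inj₁-inj₂ : ∀ {n} {i j : Fin n} → toℕ i ≤ toℕ j → inj₁ i ≺ inj₂ j
≤⇒≺-inj₁-inj₂ {i = i} {j} i≤j =
  subst (2 * toℕ i <_) (+-comm 1 (2 * toℕ j)) (s≤s (*-monoʳ-≤ 2 i≤j))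

toℕ-≮∧≯⇒≡ : ∀ {n} {u w : Fin n} → toℕ u ≮ toℕ w → toℕ w ≮ toℕ u → u ≡ w
toℕ-≮∧≯⇒≡ u≮w w≮u = toℕ-injective (≤-antisym (≮⇒≥ w≮u) (≮⇒≥ u≮w))

IndexIn : ∀ {n} → Subset n → ℕ → Set
IndexIn {n} S m = Σ (Fin n) λ i → toℕ i ≡ m × i ∈ S

IndexIn? : ∀ {n} (S : Subset n) → Decidable (IndexIn S)
IndexIn? S m = any? λ i → (toℕ i ≟ m) ×-dec (i ∈? S)

module _ {n : ℕ} (I J : Subset n) where

  private
    G : Fin n → Fin n → Set
    G = GEdge I J

  PrecImage : Fin n → Set
  PrecImage c = Σ (Fin n) λ j → j ∈ J × PrecIs I J j c

  GEdge-source∈I : ∀ {a b} → G a b → a ∈ I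
  GEdge-source∈I ((a∈I , _) , _) = a∈I

  GEdge-increasing : ∀ {a b} → G a b → toℕ a < toℕ b
  GEdge-increasing ((_ , _ , a<b) , _) = a<b

  GEdge-target∈PrecImage : ∀ {a b} → G a b → PrecImage b
  GEdge-target∈PrecImage ((_ , b∈P , _) , _) = b∈P

  GEdge-noShortcut : ∀ {a b c} → G a b → c ∈ I → PrecImage c →
                     toℕ a < toℕ c → toℕ c < toℕ b → ⊥
  GEdge-noShortcut {c = c} ((a∈I , b∈P , _) , minimal) c∈I c∈P a<c c<b =
    minimal (c , (a∈I , c∈P , a<c) , edge (c∈I , b∈P , c<b))

  PrecImage-∉⇒∈ : ∀ {v} → PrecImage v → v ∉ I → v ∈ J
  PrecImage-∉⇒∈ (j , j∈J , inj₁ (v∈I , _)) v∉I = contradiction v∈I v∉I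
  PrecImage-∉⇒∈ (j , j∈J , inj₂ (_ , refl)) _      = j∈J

  -- s is the last element of I below v, and j̄ the first element of J̄ after s, so s = prec(j̄)
  PrecImage-between : ∀ {w v} → w ∈ I → v ∈ J → v ∉ I → toℕ w < toℕ v →
                      Σ (Fin n) λ s → s ∈ I × PrecImage s × toℕ w ≤ toℕ s × toℕ s < toℕ v
  PrecImage-between {w} {v} w∈I v∈J v∉I w<v
    with greatest-below (λ m → toℕ w ≤? m ×-dec IndexIn? I m) (toℕ v) w<v
                        (≤-refl , w , refl , w∈I)
  ... | _ , s<v , (w≤s , s , refl , s∈I) , s-maximal
    with least-upTo (λ m → toℕ s ≤? m ×-dec IndexIn? J m) (toℕ v) (<⇒≤ s<v , v , refl , v∈J)
  ... | _ , j≤v , (s≤j , j , refl , j∈J) , j-minimal =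
    s , s∈I , (j , j∈J , inj₁ (s∈I , ≤⇒≺-inj₁-inj₂ s≤j , nothingBetween)) , w≤s , s<v
    where
      nothingBetween : ∀ z → InU I J z → inj₁ s ≺ z → z ≺ inj₂ j → ⊥
      nothingBetween (inj₁ i) i∈I s≺i i≺j with m≤n⇒m<n∨m≡n (≤-trans (≺-inj₁-inj₂ i≺j) j≤v)
      ... | inj₁ i<v = s-maximal s<i i<v (≤-trans w≤s (<⇒≤ s<i) , i , refl , i∈I)
        where s<i = ≺-inj₁ s≺i
      ... | inj₂ i≡v = v∉I (subst (_∈ I) (toℕ-injective i≡v) i∈I)
      nothingBetween (inj₂ k) k∈J s≺k k≺j =
        j-minimal (≺-inj₂ k≺j) (≺-inj₁-inj₂ s≺k , k , refl , k∈J)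

  rank : Fin n → ℕ
  rank v with v ∈? I
  ... | yes _ = suc (toℕ v)
  ... | no _  = 0

  rank-∈ : ∀ {v} → v ∈ I → rank v ≡ suc (toℕ v)
  rank-∈ {v} v∈I with v ∈? I
  ... | yes _   = refl
  ... | no v∉I = contradiction v∈I v∉I

  rank-∉ : ∀ {v} → v ∉ I → rank v ≡ 0
  rank-∉ {v} v∉I with v ∈? I
  ... | yes v∈I = contradiction v∈I v∉I
  ... | no _    = refl

  GEdge⇒rank≢ : ∀ {a b} → G a b → rank a ≢ rank b
  GEdge⇒rank≢ {a} {b} e = case b ∈? I of λ
    { (yes b∈I) → subst₂ _≢_ (sym rank-a) (sym (rank-∈ b∈I))
                    (<⇒≢ (s≤s (GEdge-increasing e)))
    ; (no b∉I)  → subst₂ _≢_ (sym rank-a) (sym (rank-∉ b∉I)) λ ()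
    }
    where
      rank-a : rank a ≡ suc (toℕ a)
      rank-a = rank-∈ (GEdge-source∈I e)

  adjacent⇒rank≢ : ∀ {a b} → UAdj G a b → rank a ≢ rank b
  adjacent⇒rank≢ (inj₁ e) = GEdge⇒rank≢ e
  adjacent⇒rank≢ (inj₂ e) = ≢-sym (GEdge⇒rank≢ e)

  higherNeighbour-∈ : ∀ {v u} → v ∈ I → UAdj G v u → rank v < rank u → G v u × u ∈ I
  higherNeighbour-∈ {v} {u} v∈I vu v<u = case u ∈? I of λ where
    (no u∉I)  → contradiction (subst (rank v <_) (rank-∉ u∉I) v<u) λ ()
    (yes u∈I) → case vu of λ where
      (inj₁ e) → e , u∈I
      (inj₂ e) → contradiction (subst₂ _<_ (rank-∈ v∈I) (rank-∈ u∈I) v<u)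
                               (<-asym (s≤s (GEdge-increasing e)))

  outNeighbours-unique : ∀ {v u w} → G v u → G v w → u ∈ I → w ∈ I → u ≡ w
  outNeighbours-unique vu vw u∈I w∈I = toℕ-≮∧≯⇒≡ (noShortcut vu vw u∈I) (noShortcut vw vu w∈I)
    where
      noShortcut : ∀ {v u w} → G v u → G v w → u ∈ I → toℕ u ≮ toℕ w
      noShortcut vu vw u∈I =
        GEdge-noShortcut vw u∈I (GEdge-target∈PrecImage vu) (GEdge-increasing vu)

  neighbour-∉ : ∀ {v u} → v ∉ I → UAdj G v u → G u v
  neighbour-∉ v∉I (inj₁ e) = contradiction (GEdge-source∈I e) v∉I
  neighbour-∉ v∉I (inj₂ e) = e

  inNeighbours-unique : ∀ {v u w} → v ∉ I → G u v → G w v → u ≡ w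
  inNeighbours-unique {v} v∉I uv wv = toℕ-≮∧≯⇒≡ (noShortcut uv wv) (noShortcut wv uv)
    where
      noShortcut : ∀ {u w} → G u v → G w v → toℕ u ≮ toℕ w
      noShortcut uv wv u<w
        with PrecImage-between (GEdge-source∈I wv) (PrecImage-∉⇒∈ (GEdge-target∈PrecImage uv) v∉I)
                               v∉I (GEdge-increasing wv)
      ... | s , s∈I , s∈P , w≤s , s<v = GEdge-noShortcut uv s∈I s∈P (<-≤-trans u<w w≤s) s<v

  higherNeighbour-unique : ∀ {v u w} → UAdj G v u → UAdj G v w →
                           rank v < rank u → rank v < rank w → u ≡ w
  higherNeighbour-unique {v} vu vw v<u v<w = case v ∈? I of λ where
    (yes v∈I) → let (vu′ , u∈I) = higherNeighbour-∈ v∈I vu v<u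
                    (vw′ , w∈I) = higherNeighbour-∈ v∈I vw v<w
                in outNeighbours-unique vu′ vw′ u∈I w∈I
    (no v∉I)  → inNeighbours-unique v∉I (neighbour-∉ v∉I vu) (neighbour-∉ v∉I vw)

lemma3p8 : ∀ (n : ℕ) (I J : Subset n) → Valid I J → UAcyclic (GEdge I J)
lemma3p8 n I J _ =
  Ranked.acyclic (GEdge I J) (rank I J) (adjacent⇒rank≢ I J) (higherNeighbour-unique I J)
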